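{- Let $G=(V,E)$ be a graph with positive integer edge weights and terminal set $T=\{t_1,\dots,t_p\}$. For any non-terminal vertex $v$ and any terminal $t_i$, the subgraph of $G$ induced by the extension $X_i(v)$ is connected (the empty graph counting as connected).
   Context: $G$ is a simple undirected graph with edge weights $w(e)\in\mathbb{Z}_{>0}$. For $X\subseteq V$, $d(X)$ is the total weight of edges with exactly one end in $X$. For disjoint nonempty $S,T'\subseteq V$, an $(S,T')$-cut is a set $X$ with $S\subseteq X\subseteq V\setminus T'$; a minimum $(S,T')$-cut is one minimizing $d(X)$; among minimum $(S,T')$-cuts there is a unique one containing all others, called the maximum volume minimum $(S,T')$-cut. For a non-terminal vertex $v$ and terminal $t_i$, let $C'$ be the maximum volume minimum $(\{t_i,v\},T\setminus\{t_i\})$-cut and $C$ the maximum volume minimum $(\{t_i\},T\setminus\{t_i\})$-cut; the extension of $v$ from $t_i$ is $X_i(v)=C'\setminus C$, and the distance of $v$ from $t_i$ is $ext_i(v)=d(C')-d(C)$. -}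

module Defs where

open import Data.Nat using (ℕ; _+_; _≤_; _>_)
open import Data.Bool using (Bool; true; false; if_then_else_)
open import Data.Fin using (Fin)
open import Data.Fin.Subset using (Subset; _∈_; _∉_; _⊆_; _∪_; _∩_; ∁; ⁅_⁆; Empty)
open import Data.Vec using (lookup)
open import Data.List using (List; allFin; map)
open import Data.Nat.ListAction using (sum)
open import Data.Product using (_×_)
open import Relation.Binary.PropositionalEquality using (_≡_)

-- A simple undirected graph on vertex set Fin n with positive integer edge
-- weights, encoded as a weight function: w u v = 0 means "no edge",
-- w u v > 0 is the weight of the edge uv.
record WGraph (n : ℕ) : Set where
  field
    w     : Fin n → Fin n → ℕ
    sym   : ∀ u v → w u v ≡ w v u
    loopless : ∀ u → w u u ≡ 0
open WGraph public

Σv : ∀ {n} → (Fin n → ℕ) → ℕ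
Σv {n} f = sum (map f (allFin n))

crossW : ∀ {n} → WGraph n → Subset n → Fin n → Fin n → ℕ
crossW G X u v with lookup X u | lookup X v
... | true  | false = w G u v
... | _     | _     = 0

-- d(X): total weight of edges with exactly one end in X
-- (each such edge counted once, via its endpoint inside X)
d : ∀ {n} → WGraph n → Subset n → ℕ
d G X = Σv (λ u → Σv (λ v → crossW G X u v))

IsCut : ∀ {n} → Subset n → Subset n → Subset n → Set
IsCut S T' X = (S ⊆ X) × (X ⊆ ∁ T')

IsMinCut : ∀ {n} → WGraph n → Subset n → Subset n → Subset n → Set
IsMinCut G S T' X = IsCut S T' X × (∀ Y → IsCut S T' Y → d G X ≤ d G Y)

IsMaxVolMinCut : ∀ {n} → WGraph n → Subset n → Subset n → Subset n → Set
IsMaxVolMinCut G S T' X = IsMinCut G S T' X × (∀ Y → IsMinCut G S T' Y → Y ⊆ X)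

_∖_ : ∀ {n} → Subset n → Subset n → Subset n
A ∖ B = A ∩ ∁ B

data Reach {n} (G : WGraph n) (X : Subset n) : Fin n → Fin n → Set where
  here : ∀ {u} → u ∈ X → Reach G X u u
  step : ∀ {u v x} → u ∈ X → w G u v > 0 → Reach G X v x → Reach G X u x

InducedConnected : ∀ {n} → WGraph n → Subset n → Set
InducedConnected G X = ∀ {u v} → u ∈ X → v ∈ X → Reach G X u v

-- Uncrossing C with C' shows that C ∪ C' is again a minimum cut for the larger
-- source set {tᵢ, v}, so C ⊆ C'. Let K be the component of v in G[C' ∖ C] and
-- B = (C' ∖ C) ∖ K. As no edge joins K and B, d is modular on the pair C' ∖ B,
-- C ∪ B, whose union is C' and intersection C: d(C' ∖ B) + d(C ∪ B) ≤ d(C') + d(C).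
-- Since C' ∖ B is still a cut for {tᵢ, v}, d(C ∪ B) ≤ d(C); so C ∪ B is a
-- minimum cut for tᵢ, lies in C by maximality, and B is empty.
module Submission where

open import Defs hiding (sym)
open import Data.Bool using (Bool; true; false; _∧_; _∨_)
open import Data.Fin using (Fin)
open import Data.Fin.Properties using (any?)
open import Data.Fin.Subset using (Subset; _∈_; _∉_; _⊆_; _∪_; _∩_; ∁; ⁅_⁆; ∣_∣; ⊤)
open import Data.Fin.Subset.Properties
  using ( _∈?_; x∈p∪q⁻; x∈p∩q⁺; x∈p∩q⁻; p⊆p∪q; q⊆p∪q; x∈⁅x⁆; x∈⁅y⁆⇒x≡y
        ; x∈∁p⇒x∉p; x∉p⇒x∈∁p; ⊆-antisym; ⊆-trans; ⊆⊤; ∣p∣≤n; ∣p∣≡n⇒p≡⊤; p⊂q⇒∣p∣<∣q∣)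
open import Data.List using (List; []; _∷_; map; allFin)
open import Data.Nat using (ℕ; zero; suc; _+_; _≤_; _<_; _>_; z≤n; _<?_)
open import Data.Nat.ListAction using (sum)
open import Data.Nat.Properties
  using ( ≤-refl; ≤-reflexive; ≤-trans; ≤-antisym; +-identityʳ; +-suc; +-mono-≤; +-monoˡ-≤
        ; +-cancelʳ-≤; +-comm; m≤n+m; ≮⇒≥; n≤0⇒n≡0; +-commutativeSemigroup; module ≤-Reasoning)
open import Algebra.Properties.CommutativeSemigroup +-commutativeSemigroup using (interchange)
open import Data.Product using (Σ; ∃; _×_; _,_; proj₁; proj₂)
open import Data.Sum using (inj₁; inj₂; [_,_]′)
open import Data.Vec using (lookup; tabulate)
open import Data.Vec.Properties using (lookup∘tabulate; lookup-zipWith; []=⇒lookup; lookup⇒[]=)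
open import Function using (_∘_)
open import Relation.Nullary using (does; yes; no; contradiction)
open import Relation.Nullary.Decidable using (dec-true; _×-dec_; ¬?)
open import Relation.Unary using (Pred; Decidable)
open import Relation.Binary.PropositionalEquality using (_≡_; refl; sym; trans; cong₂; subst; subst₂)

≤-cancel-dominated : ∀ {a b c e} → c ≤ b → a + b ≤ c + e → a ≤ e
≤-cancel-dominated {a} {b} {c} {e} c≤b a+b≤c+e =
  +-cancelʳ-≤ b a e (≤-trans a+b≤c+e (≤-trans (+-monoˡ-≤ e c≤b) (≤-reflexive (+-comm b e))))

sum-map-+-mono : ∀ {A : Set} (f g f' g' : A → ℕ) (xs : List A) →
  (∀ x → f x + g x ≤ f' x + g' x) →
  sum (map f xs) + sum (map g xs) ≤ sum (map f' xs) + sum (map g' xs)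
sum-map-+-mono f g f' g' []       _ = z≤n
sum-map-+-mono f g f' g' (x ∷ xs) h = begin
  (f x + sum (map f xs)) + (g x + sum (map g xs))     ≡⟨ interchange (f x) _ (g x) _ ⟩
  (f x + g x) + (sum (map f xs) + sum (map g xs))     ≤⟨ +-mono-≤ (h x) (sum-map-+-mono f g f' g' xs h) ⟩
  (f' x + g' x) + (sum (map f' xs) + sum (map g' xs)) ≡⟨ interchange (f' x) _ (g' x) _ ⟨
  (f' x + sum (map f' xs)) + (g' x + sum (map g' xs)) ∎
  where open ≤-Reasoning

Σv-+-mono : ∀ {n} (f g f' g' : Fin n → ℕ) →
  (∀ x → f x + g x ≤ f' x + g' x) → Σv f + Σv g ≤ Σv f' + Σv g'
Σv-+-mono {n} f g f' g' = sum-map-+-mono f g f' g' (allFin n)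

cross : Bool → Bool → ℕ → ℕ
cross true false k = k
cross _    _     _ = 0

cross-submodular : ∀ a p b q k →
  cross (a ∨ p) (b ∨ q) k + cross (a ∧ p) (b ∧ q) k ≤ cross a b k + cross p q k
cross-submodular true  true  true  true  k = z≤n
cross-submodular true  true  true  false k = ≤-refl
cross-submodular true  true  false true  k = ≤-reflexive (sym (+-identityʳ k))
cross-submodular true  true  false false k = ≤-refl
cross-submodular true  false true  true  k = z≤n
cross-submodular true  false true  false k = z≤n
cross-submodular true  false false true  k = z≤n
cross-submodular true  false false false k = ≤-refl
cross-submodular false true  true  true  k = z≤n
cross-submodular false true  true  false k = z≤n
cross-submodular false true  false true  k = z≤n
cross-submodular false true  false false k = ≤-reflexive (+-identityʳ k)
cross-submodular false false true  true  k = z≤n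
cross-submodular false false true  false k = z≤n
cross-submodular false false false true  k = z≤n
cross-submodular false false false false k = z≤n

cross-modular : ∀ a p b q k →
  (a ≡ true → p ≡ false → b ≡ false → q ≡ true → k ≡ 0) →
  (a ≡ false → p ≡ true → b ≡ true → q ≡ false → k ≡ 0) →
  cross a b k + cross p q k ≤ cross (a ∨ p) (b ∨ q) k + cross (a ∧ p) (b ∧ q) k
cross-modular true  true  true  true  k _  _  = z≤n
cross-modular true  true  true  false k _  _  = ≤-refl
cross-modular true  true  false true  k _  _  = ≤-reflexive (+-identityʳ k)
cross-modular true  true  false false k _  _  = ≤-refl
cross-modular true  false true  true  k _  _  = z≤n
cross-modular true  false true  false k _  _  = z≤n
cross-modular true  false false true  k h₁ _  rewrite h₁ refl refl refl refl = z≤n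
cross-modular true  false false false k _  _  = ≤-refl
cross-modular false true  true  true  k _  _  = z≤n
cross-modular false true  true  false k _  h₂ rewrite h₂ refl refl refl refl = z≤n
cross-modular false true  false true  k _  _  = z≤n
cross-modular false true  false false k _  _  = ≤-reflexive (sym (+-identityʳ k))
cross-modular false false true  true  k _  _  = z≤n
cross-modular false false true  false k _  _  = z≤n
cross-modular false false false true  k _  _  = z≤n
cross-modular false false false false k _  _  = z≤n

∈⇒lookup≡true : ∀ {n} {X : Subset n} {u} → u ∈ X → lookup X u ≡ true
∈⇒lookup≡true = []=⇒lookup

lookup≡true⇒∈ : ∀ {n} {X : Subset n} {u} → lookup X u ≡ true → u ∈ X
lookup≡true⇒∈ {X = X} {u} = lookup⇒[]= u X

lookup≡false⇒∉ : ∀ {n} {X : Subset n} {u} → lookup X u ≡ false → u ∉ X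
lookup≡false⇒∉ X[u]≡false u∈X with () ← trans (sym X[u]≡false) (∈⇒lookup≡true u∈X)

∈∖⁺ : ∀ {n} {X Y : Subset n} {u} → u ∈ X → u ∉ Y → u ∈ X ∖ Y
∈∖⁺ u∈X u∉Y = x∈p∩q⁺ (u∈X , x∉p⇒x∈∁p u∉Y)

∈∖⁻ : ∀ {n} {X Y : Subset n} {u} → u ∈ X ∖ Y → u ∈ X × u ∉ Y
∈∖⁻ {X = X} {Y} u∈X∖Y with u∈X , u∈∁Y ← x∈p∩q⁻ X (∁ Y) u∈X∖Y = u∈X , x∈∁p⇒x∉p u∈∁Y

module _ {n} (G : WGraph n) where

  crossW≡cross : ∀ X u v → crossW G X u v ≡ cross (lookup X u) (lookup X v) (w G u v)
  crossW≡cross X u v with lookup X u | lookup X v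
  ... | true  | true  = refl
  ... | true  | false = refl
  ... | false | _     = refl

  crossW-∪+∩ : ∀ X Y u v →
    crossW G (X ∪ Y) u v + crossW G (X ∩ Y) u v ≡
    cross (lookup X u ∨ lookup Y u) (lookup X v ∨ lookup Y v) (w G u v) +
    cross (lookup X u ∧ lookup Y u) (lookup X v ∧ lookup Y v) (w G u v)
  crossW-∪+∩ X Y u v
    rewrite crossW≡cross (X ∪ Y) u v | crossW≡cross (X ∩ Y) u v
          | lookup-zipWith _∨_ u X Y | lookup-zipWith _∨_ v X Y
          | lookup-zipWith _∧_ u X Y | lookup-zipWith _∧_ v X Y = refl

  crossW-+ : ∀ X Y u v →
    crossW G X u v + crossW G Y u v ≡
    cross (lookup X u) (lookup X v) (w G u v) + cross (lookup Y u) (lookup Y v) (w G u v)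
  crossW-+ X Y u v = cong₂ _+_ (crossW≡cross X u v) (crossW≡cross Y u v)

  d-+-mono : ∀ {X Y X' Y'} →
    (∀ u v → crossW G X u v + crossW G Y u v ≤ crossW G X' u v + crossW G Y' u v) →
    d G X + d G Y ≤ d G X' + d G Y'
  d-+-mono {X} {Y} {X'} {Y'} h =
    Σv-+-mono _ _ _ _ λ u →
      Σv-+-mono (crossW G X u) (crossW G Y u) (crossW G X' u) (crossW G Y' u) (h u)

  d-submodular : ∀ X Y → d G (X ∪ Y) + d G (X ∩ Y) ≤ d G X + d G Y
  d-submodular X Y = d-+-mono {X ∪ Y} {X ∩ Y} {X} {Y} λ u v →
    subst₂ _≤_ (sym (crossW-∪+∩ X Y u v)) (sym (crossW-+ X Y u v))
      (cross-submodular (lookup X u) (lookup Y u) (lookup X v) (lookup Y v) (w G u v))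

  d-modular : ∀ X Y → (∀ {u v} → u ∈ X ∖ Y → v ∈ Y ∖ X → w G u v ≡ 0) →
    d G X + d G Y ≤ d G (X ∪ Y) + d G (X ∩ Y)
  d-modular X Y unlinked = d-+-mono {X} {Y} {X ∪ Y} {X ∩ Y} λ u v →
    subst₂ _≤_ (sym (crossW-+ X Y u v)) (sym (crossW-∪+∩ X Y u v))
      (cross-modular (lookup X u) (lookup Y u) (lookup X v) (lookup Y v) (w G u v)
        (λ Xu Yu Xv Yv → unlinked (∈∖⁺ (lookup≡true⇒∈ Xu) (lookup≡false⇒∉ Yu))
                                  (∈∖⁺ (lookup≡true⇒∈ Yv) (lookup≡false⇒∉ Xv)))
        (λ Xu Yu Xv Yv → trans (WGraph.sym G u v)
                           (unlinked (∈∖⁺ (lookup≡true⇒∈ Xv) (lookup≡false⇒∉ Yv))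
                                     (∈∖⁺ (lookup≡true⇒∈ Yu) (lookup≡false⇒∉ Xu)))))

module Exchange {n} {C C' B : Subset n} (C⊆C' : C ⊆ C') (B⊆C'∖C : B ⊆ C' ∖ C) where

  B⊆C' : B ⊆ C'
  B⊆C' = proj₁ ∘ ∈∖⁻ ∘ B⊆C'∖C

  C⊆C'∖B : C ⊆ C' ∖ B
  C⊆C'∖B x∈C = ∈∖⁺ (C⊆C' x∈C) λ x∈B → proj₂ (∈∖⁻ (B⊆C'∖C x∈B)) x∈C

  C'⊆exchange-∪ : C' ⊆ (C ∪ B) ∪ (C' ∖ B)
  C'⊆exchange-∪ {x} x∈C' with x ∈? B
  ... | yes x∈B = p⊆p∪q (C' ∖ B) (q⊆p∪q C B x∈B)
  ... | no  x∉B = q⊆p∪q (C ∪ B) (C' ∖ B) (∈∖⁺ x∈C' x∉B)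

  ∪-exchange : (C ∪ B) ∪ (C' ∖ B) ≡ C'
  ∪-exchange = ⊆-antisym
    (λ x∈ → [ [ C⊆C' , B⊆C' ]′ ∘ x∈p∪q⁻ C B , proj₁ ∘ ∈∖⁻ ]′ (x∈p∪q⁻ (C ∪ B) (C' ∖ B) x∈))
    C'⊆exchange-∪

  exchange-∩⊆C : (C ∪ B) ∩ (C' ∖ B) ⊆ C
  exchange-∩⊆C x∈ with x∈C∪B , x∈C'∖B ← x∈p∩q⁻ (C ∪ B) (C' ∖ B) x∈ with x∈p∪q⁻ C B x∈C∪B
  ... | inj₁ x∈C = x∈C
  ... | inj₂ x∈B = contradiction x∈B (proj₂ (∈∖⁻ x∈C'∖B))

  ∩-exchange : (C ∪ B) ∩ (C' ∖ B) ≡ C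
  ∩-exchange = ⊆-antisym exchange-∩⊆C λ x∈C → x∈p∩q⁺ (p⊆p∪q B x∈C , C⊆C'∖B x∈C)

  exchanged-part : (C ∪ B) ∖ (C' ∖ B) ⊆ B
  exchanged-part x∈ with x∈C∪B , x∉C'∖B ← ∈∖⁻ x∈ with x∈p∪q⁻ C B x∈C∪B
  ... | inj₁ x∈C = contradiction (C⊆C'∖B x∈C) x∉C'∖B
  ... | inj₂ x∈B = x∈B

  exchanged-rest : (C' ∖ B) ∖ (C ∪ B) ⊆ (C' ∖ C) ∖ B
  exchanged-rest x∈ with x∈C'∖B , x∉C∪B ← ∈∖⁻ x∈ with x∈C' , x∉B ← ∈∖⁻ {Y = B} x∈C'∖B =
    ∈∖⁺ (∈∖⁺ x∈C' (x∉C∪B ∘ p⊆p∪q B)) x∉B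

module _ {n} (G : WGraph n) {T' : Subset n} where

  minCut-of-≤ : ∀ {S C X} → IsMinCut G S T' C → IsCut S T' X → d G X ≤ d G C → IsMinCut G S T' X
  minCut-of-≤ (_ , minC) cutX dX≤dC = cutX , λ Y cutY → ≤-trans dX≤dC (minC Y cutY)

  minCut⊆maxVolMinCut : ∀ {S S' C C'} → S ⊆ S' →
    IsMinCut G S T' C → IsMaxVolMinCut G S' T' C' → C ⊆ C'
  minCut⊆maxVolMinCut {S} {S'} {C} {C'} S⊆S'
    minCutC@((S⊆C , C⊆∁T') , _) (minCutC'@((S'⊆C' , C'⊆∁T') , _) , maxC') =
    ⊆-trans (p⊆p∪q C') (maxC' (C ∪ C') (minCut-of-≤ minCutC' ∪-cut d∪≤dC'))
    where
    ∪-cut : IsCut S' T' (C ∪ C')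
    ∪-cut = (λ x∈S' → q⊆p∪q C C' (S'⊆C' x∈S'))
          , (λ x∈C∪C' → [ C⊆∁T' , C'⊆∁T' ]′ (x∈p∪q⁻ C C' x∈C∪C'))
    ∩-cut : IsCut S T' (C ∩ C')
    ∩-cut = (λ x∈S → x∈p∩q⁺ (S⊆C x∈S , S'⊆C' (S⊆S' x∈S)))
          , (λ x∈C∩C' → C⊆∁T' (proj₁ (x∈p∩q⁻ C C' x∈C∩C')))
    d∪≤dC' : d G (C ∪ C') ≤ d G C'
    d∪≤dC' = ≤-cancel-dominated (proj₂ minCutC (C ∩ C') ∩-cut) (d-submodular G C C')

  separated-part-empty : ∀ {S S' C C' B} →
    IsMaxVolMinCut G S T' C → IsMinCut G S' T' C' → C ⊆ C' →
    B ⊆ C' ∖ C → (∀ {x} → x ∈ S' → x ∉ B) →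
    (∀ {a b} → a ∈ (C' ∖ C) ∖ B → b ∈ B → w G a b ≡ 0) →
    ∀ {x} → x ∉ B
  separated-part-empty {S} {S'} {C} {C'} {B}
    (minCutC@((S⊆C , C⊆∁T') , _) , maxC) ((S'⊆C' , C'⊆∁T') , minC')
    C⊆C' B⊆C'∖C S'∉B unlinked x∈B =
    proj₂ (∈∖⁻ (B⊆C'∖C x∈B)) (Q⊆C (q⊆p∪q C B x∈B))
    where
    open Exchange C⊆C' B⊆C'∖C

    Q P : Subset n
    Q = C ∪ B
    P = C' ∖ B

    Q-cut : IsCut S T' Q
    Q-cut = (λ x∈S → p⊆p∪q B (S⊆C x∈S)) , λ x∈Q → [ C⊆∁T' , C'⊆∁T' ∘ B⊆C' ]′ (x∈p∪q⁻ C B x∈Q)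

    P-cut : IsCut S' T' P
    P-cut = (λ x∈S' → ∈∖⁺ (S'⊆C' x∈S') (S'∉B x∈S')) , C'⊆∁T' ∘ proj₁ ∘ ∈∖⁻

    dQ+dP≤dC'+dC : d G Q + d G P ≤ d G C' + d G C
    dQ+dP≤dC'+dC = subst₂ (λ U I → d G Q + d G P ≤ d G U + d G I) ∪-exchange ∩-exchange
      (d-modular G Q P λ u∈Q∖P v∈P∖Q →
        trans (WGraph.sym G _ _) (unlinked (exchanged-rest v∈P∖Q) (exchanged-part u∈Q∖P)))

    Q⊆C : Q ⊆ C
    Q⊆C = maxC Q (minCut-of-≤ minCutC Q-cut (≤-cancel-dominated (minC' P P-cut) dQ+dP≤dC'+dC))

module _ {n} {G : WGraph n} {X : Subset n} where

  reach-snoc : ∀ {u y z} → Reach G X u y → z ∈ X → w G y z > 0 → Reach G X u z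
  reach-snoc (here u∈X)           z∈X y~z = step u∈X y~z (here z∈X)
  reach-snoc (step u∈X u~u' walk) z∈X y~z = step u∈X u~u' (reach-snoc walk z∈X y~z)

  reach-sym : ∀ {u y} → Reach G X u y → Reach G X y u
  reach-sym (here u∈X)                    = here u∈X
  reach-sym (step {u} {u'} u∈X u~u' walk) =
    reach-snoc (reach-sym walk) u∈X (subst (0 <_) (WGraph.sym G u u') u~u')

  reach-trans : ∀ {u y z} → Reach G X u y → Reach G X y z → Reach G X u z
  reach-trans (here _)              walk' = walk'
  reach-trans (step u∈X u~u' walk) walk' = step u∈X u~u' (reach-trans walk walk')

fromDec : ∀ {n ℓ} {P : Pred (Fin n) ℓ} → Decidable P → Subset n
fromDec P? = tabulate (does ∘ P?)

module _ {n ℓ} {P : Pred (Fin n) ℓ} (P? : Decidable P) where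

  ∈-fromDec⁺ : ∀ {x} → P x → x ∈ fromDec P?
  ∈-fromDec⁺ {x} Px = lookup≡true⇒∈ (trans (lookup∘tabulate (does ∘ P?) x) (dec-true (P? x) Px))

  ∈-fromDec⁻ : ∀ {x} → x ∈ fromDec P? → P x
  ∈-fromDec⁻ {x} x∈ with P? x | trans (sym (lookup∘tabulate (does ∘ P?) x)) (∈⇒lookup≡true x∈)
  ... | yes Px | _  = Px
  ... | no  _  | ()

module _ {n ℓ} (f : Subset n → Subset n) (inflationary : ∀ R → R ⊆ f R)
         (Inv : Subset n → Set ℓ) (preserves : ∀ {R} → Inv R → Inv (f R)) where

  -- The fuel k bounds the number of elements R still lacks: an unstable round adds one.
  closure-within : ∀ k R → n ≤ ∣ R ∣ + k → Inv R →
    Σ (Subset n) λ R' → R ⊆ R' × Inv R' × f R' ⊆ R'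
  closure-within zero R n≤∣R∣+0 inv =
    R , (λ x∈R → x∈R) , inv , λ {x} x∈fR → subst (x ∈_) (sym R≡⊤) (⊆⊤ x∈fR)
    where
    R≡⊤ : R ≡ ⊤
    R≡⊤ = ∣p∣≡n⇒p≡⊤ (≤-antisym (∣p∣≤n R) (subst (n ≤_) (+-identityʳ ∣ R ∣) n≤∣R∣+0))
  closure-within (suc k) R n≤∣R∣+1+k inv with any? (λ x → x ∈? f R ×-dec ¬? (x ∈? R))
  ... | no ∄new = R , (λ x∈R → x∈R) , inv , f[R]⊆R
    where
    f[R]⊆R : f R ⊆ R
    f[R]⊆R {x} x∈fR with x ∈? R
    ... | yes x∈R = x∈R
    ... | no  x∉R = contradiction (x , x∈fR , x∉R) ∄new
  ... | yes new =
    let R' , f[R]⊆R' , inv' , closed = closure-within k (f R) n≤∣fR∣+k (preserves inv)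
    in  R' , f[R]⊆R' ∘ inflationary R , inv' , closed
    where
    n≤∣fR∣+k : n ≤ ∣ f R ∣ + k
    n≤∣fR∣+k = ≤-trans (subst (n ≤_) (+-suc ∣ R ∣ k) n≤∣R∣+1+k)
                       (+-monoˡ-≤ k (p⊂q⇒∣p∣<∣q∣ (inflationary R , new)))

  closure : ∀ R → Inv R → Σ (Subset n) λ R' → R ⊆ R' × Inv R' × f R' ⊆ R'
  closure R = closure-within n R (m≤n+m n ∣ R ∣)

record Component {n} (G : WGraph n) (X : Subset n) (v : Fin n) : Set where
  field
    vertices  : Subset n
    reachable : ∀ {u} → u ∈ vertices → Reach G X v u
    root      : v ∈ X → v ∈ vertices
    closed    : ∀ {u y} → u ∈ vertices → y ∈ X → w G u y > 0 → y ∈ vertices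

module _ {n} (G : WGraph n) (X : Subset n) (v : Fin n) where

  private
    adjacent? : ∀ R → Decidable (λ y → y ∈ X × ∃ λ z → z ∈ R × w G z y > 0)
    adjacent? R y = y ∈? X ×-dec any? (λ z → z ∈? R ×-dec 0 <? w G z y)

    expand : Subset n → Subset n
    expand R = R ∪ fromDec (adjacent? R)

    Reached : Subset n → Set
    Reached R = ∀ {u} → u ∈ R → Reach G X v u

    expand-reached : ∀ {R} → Reached R → Reached (expand R)
    expand-reached {R} reached u∈ with x∈p∪q⁻ R _ u∈
    ... | inj₁ u∈R = reached u∈R
    ... | inj₂ new with u∈X , z , z∈R , z~u ← ∈-fromDec⁻ (adjacent? R) new =
      reach-snoc (reached z∈R) u∈X z~u

    start-reached : Reached (X ∩ ⁅ v ⁆)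
    start-reached u∈ with u∈X , u∈⁅v⁆ ← x∈p∩q⁻ X ⁅ v ⁆ u∈ with refl ← x∈⁅y⁆⇒x≡y v u∈⁅v⁆ = here u∈X

  component : Component G X v
  component
    with K , start⊆K , K-reached , K-stable
           ← closure expand (λ R → p⊆p∪q _) Reached expand-reached (X ∩ ⁅ v ⁆) start-reached =
    record
      { vertices  = K
      ; reachable = K-reached
      ; root      = λ v∈X → start⊆K (x∈p∩q⁺ (v∈X , x∈⁅x⁆ v))
      ; closed    = λ u∈K y∈X u~y →
          K-stable (q⊆p∪q K _ (∈-fromDec⁺ (adjacent? K) (y∈X , _ , u∈K , u~y)))
      }

lemma2 : ∀ {n} (G : WGraph n) (T : Subset n) (v tᵢ : Fin n) →
         v ∉ T → tᵢ ∈ T →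
         (C' C : Subset n) →
         IsMaxVolMinCut G (⁅ tᵢ ⁆ ∪ ⁅ v ⁆) (T ∖ ⁅ tᵢ ⁆) C' →
         IsMaxVolMinCut G ⁅ tᵢ ⁆ (T ∖ ⁅ tᵢ ⁆) C →
         InducedConnected G (C' ∖ C)
lemma2 {n} G T v tᵢ _ _ C' C maxC' maxC a∈X b∈X =
  reach-trans (reach-sym (reachable (∈K a∈X))) (reachable (∈K b∈X))
  where
  X : Subset n
  X = C' ∖ C

  open Component (component G X v)

  B : Subset n
  B = X ∖ vertices

  C⊆C' : C ⊆ C'
  C⊆C' = minCut⊆maxVolMinCut G (p⊆p∪q ⁅ v ⁆) (proj₁ maxC) maxC'

  ∉B⇒∈K : ∀ {x} → x ∈ X → x ∉ B → x ∈ vertices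
  ∉B⇒∈K {x} x∈X x∉B with x ∈? vertices
  ... | yes x∈K = x∈K
  ... | no  x∉K = contradiction (∈∖⁺ x∈X x∉K) x∉B

  sources∉B : ∀ {x} → x ∈ ⁅ tᵢ ⁆ ∪ ⁅ v ⁆ → x ∉ B
  sources∉B x∈S' x∈B with x∈X , x∉K ← ∈∖⁻ x∈B with x∈p∪q⁻ ⁅ tᵢ ⁆ ⁅ v ⁆ x∈S'
  ... | inj₁ x∈⁅tᵢ⁆ = proj₂ (∈∖⁻ x∈X) (proj₁ (proj₁ (proj₁ maxC)) x∈⁅tᵢ⁆)
  ... | inj₂ x∈⁅v⁆ with refl ← x∈⁅y⁆⇒x≡y v x∈⁅v⁆ = x∉K (root x∈X)

  K-B-unlinked : ∀ {a b} → a ∈ X ∖ B → b ∈ B → w G a b ≡ 0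
  K-B-unlinked a∈X∖B b∈B with a∈X , a∉B ← ∈∖⁻ a∈X∖B with b∈X , b∉K ← ∈∖⁻ b∈B =
    n≤0⇒n≡0 (≮⇒≥ λ a~b → b∉K (closed (∉B⇒∈K a∈X a∉B) b∈X a~b))

  ∈K : ∀ {x} → x ∈ X → x ∈ vertices
  ∈K x∈X = ∉B⇒∈K x∈X
    (separated-part-empty G maxC (proj₁ maxC') C⊆C' (proj₁ ∘ ∈∖⁻) sources∉B K-B-unlinked)
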